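{- Let $j\ge1$ and $\Upsilon\subseteq S_j$. Define $\Upsilon_0=\{(\tau,0^j):\tau\in\Upsilon\}$, $\Upsilon_{\mathrm{inc}}=\{(\tau,\,0~1\cdots(j-1)):\tau\in\Upsilon\}$, and $\Upsilon_{d}=\{(\tau,u):\tau\in\Upsilon,\ u\in D_j\}$, where $D_j$ is the set of all words of length $j$ that are rearrangements of $0,1,\dots,j-1$. Let $\Gamma_1=\Upsilon_0\cup\{(1\text{ - }2,0~1),(1\text{ - }2,1~0),(2\text{ - }1,0~1),(2\text{ - }1,1~0)\}$, $\Gamma_2=\Upsilon_{\mathrm{inc}}\cup\{(1\text{ - }2,1~0),(1\text{ - }2,0~0),(2\text{ - }1,1~0),(2\text{ - }1,0~0)\}$, $\Gamma_3=\Upsilon_d\cup\{(1\text{ - }2,0~0),(2\text{ - }1,0~0)\}$. Then for all $k\ge1$ and all $n\ge1$: (1) $Av_{n,k}^{\Gamma_1}=k\,Av_n^{\Upsilon}$; (2) $Av_{n,k}^{\Gamma_2}=\binom{k}{n}Av_n^{\Upsilon}$; (3) $Av_{n,k}^{\Gamma_3}=\binom{k}{n}\,n!\,Av_n^{\Upsilon}$.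
   Context: For integers $k\ge1$, $n\ge0$, $C_k\wr S_n$ denotes the set of pairs $(\sigma,w)$ where $\sigma=\sigma_1\cdots\sigma_n$ is a permutation of $\{1,\dots,n\}$ in one-line notation and $w=w_1\cdots w_n\in\{0,1,\dots,k-1\}^n$. For a sequence of distinct integers, $\mathrm{red}$ replaces the $i$-th smallest entry by $i$; for a word over nonnegative integers, $\mathrm{red}$ replaces every occurrence of the $i$-th smallest distinct letter by $i-1$. A pattern $(\tau,u)$ has $\tau\in S_m$ and $u$ a word of length $m$ with $\mathrm{red}(u)=u$; e.g. $(2\text{ - }1,1~0)$ means $\tau=21$, $u=10$. $(\tau,u)$ bi-occurs in $(\sigma,w)$ if there are $1\le i_1<\cdots<i_m\le n$ (not necessarily adjacent) with $\mathrm{red}(\sigma_{i_1}\cdots\sigma_{i_m})=\tau$ and $\mathrm{red}(w_{i_1}\cdots w_{i_m})=u$; $(\sigma,w)$ bi-avoids a set of patterns if no member bi-occurs in it. $Av_{n,k}^{\Gamma}$ is the number of elements of $C_k\wr S_n$ bi-avoiding $\Gamma$. A permutation $\sigma\in S_n$ avoids $\Upsilon$ if there are no indices $i_1<\cdots<i_j$ with $\mathrm{red}(\sigma_{i_1}\cdots\sigma_{i_j})\in\Upsilon$; $Av_n^{\Upsilon}$ is the number of such $\sigma\in S_n$. Here $\binom{k}{n}=0$ if $n>k$. -}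

module Defs where

open import Data.Nat using (ℕ; zero; suc; _<ᵇ_; _≟_)
open import Data.Bool using (Bool; true; false; _∧_; if_then_else_)
open import Data.List using (List; []; _∷_; map; _++_; length; filter; deduplicate; upTo; concatMap; zip; replicate; applyUpTo)
open import Data.Bool.ListAction using (any; all)
open import Data.List.Properties using (≡-dec)
open import Data.List.Relation.Unary.Unique.DecPropositional _≟_ using (unique?)
open import Data.Product using (_×_; _,_; proj₁; proj₂)
open import Relation.Nullary.Decidable using (⌊_⌋)

countB : {A : Set} → (A → Bool) → List A → ℕ
countB p [] = 0
countB p (x ∷ xs) = if p x then suc (countB p xs) else countB p xs

words : ℕ → List ℕ → List (List ℕ)
words zero    alph = [] ∷ []
words (suc n) alph = concatMap (λ a → map (a ∷_) (words n alph)) alph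

Sym : ℕ → List (List ℕ)
Sym n = filter (λ xs → unique? xs) (words n (applyUpTo suc n))

Dwords : ℕ → List (List ℕ)
Dwords j = filter (λ xs → unique? xs) (words j (upTo j))

-- red on a sequence of distinct integers: i-th smallest entry ↦ i
redP : List ℕ → List ℕ
redP s = map (λ x → suc (countB (λ y → y <ᵇ x) s)) s

-- red on a word: i-th smallest distinct letter ↦ i-1
redW : List ℕ → List ℕ
redW s = map (λ x → length (deduplicate _≟_ (filter (λ y → y Data.Nat.<? x) s))) s

eqL : List ℕ → List ℕ → Bool
eqL xs ys = ⌊ ≡-dec _≟_ xs ys ⌋

subseqs : {A : Set} → List A → List (List A)
subseqs [] = [] ∷ []
subseqs (x ∷ xs) = map (x ∷_) (subseqs xs) ++ subseqs xs

Pattern : Set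
Pattern = List ℕ × List ℕ

biOccurs : Pattern → List ℕ × List ℕ → Bool
biOccurs (τ , u) (σ , w) =
  any (λ p → eqL (redP (map proj₁ p)) τ ∧ eqL (redW (map proj₂ p)) u) (subseqs (zip σ w))

biAvoids : List Pattern → List ℕ × List ℕ → Bool
biAvoids Γ x = all (λ γ → Data.Bool.not (biOccurs γ x)) Γ

wreath : ℕ → ℕ → List (List ℕ × List ℕ)
wreath k n = concatMap (λ σ → map (σ ,_) (words n (upTo k))) (Sym n)

AvC : List Pattern → ℕ → ℕ → ℕ
AvC Γ n k = countB (biAvoids Γ) (wreath k n)

occursP : List (List ℕ) → List ℕ → Bool
occursP Υ σ = any (λ p → any (eqL (redP p)) Υ) (subseqs σ)

AvP : List (List ℕ) → ℕ → ℕ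
AvP Υ n = countB (λ σ → Data.Bool.not (occursP Υ σ)) (Sym n)

Υ₀ : ℕ → List (List ℕ) → List Pattern
Υ₀ j Υ = map (λ τ → τ , replicate j 0) Υ

Υinc : ℕ → List (List ℕ) → List Pattern
Υinc j Υ = map (λ τ → τ , upTo j) Υ

Υd : ℕ → List (List ℕ) → List Pattern
Υd j Υ = concatMap (λ τ → map (τ ,_) (Dwords j)) Υ

Γ₁ : ℕ → List (List ℕ) → List Pattern
Γ₁ j Υ = Υ₀ j Υ ++ ((1 ∷ 2 ∷ []) , (0 ∷ 1 ∷ [])) ∷ ((1 ∷ 2 ∷ []) , (1 ∷ 0 ∷ []))
                 ∷ ((2 ∷ 1 ∷ []) , (0 ∷ 1 ∷ [])) ∷ ((2 ∷ 1 ∷ []) , (1 ∷ 0 ∷ [])) ∷ []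

Γ₂ : ℕ → List (List ℕ) → List Pattern
Γ₂ j Υ = Υinc j Υ ++ ((1 ∷ 2 ∷ []) , (1 ∷ 0 ∷ [])) ∷ ((1 ∷ 2 ∷ []) , (0 ∷ 0 ∷ []))
                   ∷ ((2 ∷ 1 ∷ []) , (1 ∷ 0 ∷ [])) ∷ ((2 ∷ 1 ∷ []) , (0 ∷ 0 ∷ [])) ∷ []

Γ₃ : ℕ → List (List ℕ) → List Pattern
Γ₃ j Υ = Υd j Υ ++ ((1 ∷ 2 ∷ []) , (0 ∷ 0 ∷ [])) ∷ ((2 ∷ 1 ∷ []) , (0 ∷ 0 ∷ [])) ∷ []

module Submission where

-- Since σ has distinct entries, the length-two patterns of Γᵢ constrain only the word w:
-- they say that w is constant (Γ₁), strictly increasing (Γ₂) or injective (Γ₃). For such w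
-- every length-j subword reduces to 0ʲ, to 0 1 ⋯ (j-1), or into Dⱼ respectively, so the
-- Υ-part of Γᵢ bi-occurs in (σ, w) exactly when Υ occurs in σ. The count therefore factors
-- as Avₙ^Υ times the number of admissible words, and over k letters there are k constant,
-- C(k,n) increasing and C(k,n)·n! injective words of length n ≥ 1.

open import Defs
open import Data.Bool using (Bool; true; false; _∧_; _∨_; not; if_then_else_; T)
open import Data.Bool.ListAction using (any; all)
open import Data.Bool.Properties
  using (∧-comm; ∧-assoc; ∧-zeroʳ; ∧-identityʳ; ∨-assoc; ∨-identityʳ; T-∧; T-≡; T-not-≡)
open import Data.Empty using (⊥-elim)
open import Data.List
  using (List; []; _∷_; map; _++_; length; filter; concatMap; deduplicate; replicate; upTo; applyUpTo; zip)
open import Data.List.Properties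
  using (map-cong-local; map-++; map-∘; length-upTo; map-upTo; length-map; length-deduplicate;
         filter-accept; filter-reject; filter-none; filter-all; filter-notAll)
open import Data.List.Membership.Propositional using (_∈_)
open import Data.List.Membership.Propositional.Properties
  using (∈-++⁻; ∈-map⁻; ∈-concat⁻′; ∈-filter⁻; ∈-map⁺; ∈-concat⁺′; ∈-filter⁺; ∈-upTo⁺)
open import Data.List.Relation.Binary.Sublist.Propositional using (_⊆_; []; _∷_; _∷ʳ_; ⊆-refl)
open import Data.List.Relation.Binary.Sublist.Propositional.Properties as Sublist
  using (All-resp-⊆; filter⁺; length-mono-≤)
open import Data.List.Relation.Unary.All as All using (All; []; _∷_)
open import Data.List.Relation.Unary.All.Properties as All using (all⁺)
open import Data.List.Relation.Unary.AllPairs as AllPairs using (AllPairs; []; _∷_)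
import Data.List.Relation.Unary.AllPairs.Properties as AllPairs
open import Data.List.Relation.Unary.Any as Any using (here; there)
open import Data.List.Relation.Unary.Any.Properties using (any⁺; any⁻)
open import Data.List.Relation.Unary.Unique.Propositional using (Unique)
import Data.List.Relation.Unary.Unique.Propositional.Properties as Unique
open import Data.Nat using (ℕ; zero; suc; pred; _+_; _*_; _!; _≤_; _<_; _≟_; _<?_; _<ᵇ_; _≡ᵇ_; s≤s)
open import Data.Nat.Combinatorics using (_C_; nCk+nC[k+1]≡[n+1]C[k+1]; nC1≡n)
open import Data.Nat.ListAction using (sum)
open import Data.Nat.Properties
  using (+-suc; +-assoc; +-identityʳ; *-identityʳ; *-zeroʳ; *-assoc; *-comm; *-distribˡ-+; suc-injective;
         ≡ᵇ⇒≡; ≡⇒≡ᵇ; <ᵇ⇒<; <-irrefl; <-asym; <-cmp; <-trans; ≤-<-trans; m<n⇒m<1+n; <⇒≢)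
open import Data.List.Relation.Unary.Unique.DecPropositional _≟_ using (unique?)
open import Data.Product using (_×_; _,_; proj₁; proj₂)
open import Data.Sum using (inj₁; inj₂)
open import Function using (_∘_; id)
open import Function.Bundles using (Equivalence)
open import Level using (0ℓ)
open import Relation.Binary.Definitions using (tri<; tri≈; tri>)
open import Relation.Binary.PropositionalEquality
open import Relation.Nullary using (¬_; ¬?; yes; no)
open import Relation.Nullary.Decidable using (dec-true; dec-false; toWitness; fromWitness)
open import Relation.Unary using (Pred; Decidable)

private variable
  A B : Set

countB-++ : (p : A → Bool) (xs ys : List A) → countB p (xs ++ ys) ≡ countB p xs + countB p ys
countB-++ p []       ys = refl
countB-++ p (x ∷ xs) ys with p x
... | true  = cong suc (countB-++ p xs ys)
... | false = countB-++ p xs ys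

countB-map : (p : B → Bool) (f : A → B) (xs : List A) → countB p (map f xs) ≡ countB (p ∘ f) xs
countB-map p f []       = refl
countB-map p f (x ∷ xs) with p (f x)
... | true  = cong suc (countB-map p f xs)
... | false = countB-map p f xs

countB-concatMap : (p : B → Bool) (f : A → List B) (xs : List A) →
                   countB p (concatMap f xs) ≡ sum (map (countB p ∘ f) xs)
countB-concatMap p f []       = refl
countB-concatMap p f (x ∷ xs) =
  trans (countB-++ p (f x) (concatMap f xs)) (cong (countB p (f x) +_) (countB-concatMap p f xs))

countB-congᴬ : {p q : A → Bool} {xs : List A} → All (λ x → p x ≡ q x) xs → countB p xs ≡ countB q xs
countB-congᴬ []                         = refl
countB-congᴬ {q = q} {x ∷ _} (px≡qx ∷ eqs) rewrite px≡qx with q x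
... | true  = cong suc (countB-congᴬ eqs)
... | false = countB-congᴬ eqs

countB-cong : {p q : A → Bool} → (∀ x → p x ≡ q x) → (xs : List A) → countB p xs ≡ countB q xs
countB-cong p≗q xs = countB-congᴬ (All.universal p≗q xs)

countB-false : {p : A → Bool} {xs : List A} → All (λ x → p x ≡ false) xs → countB p xs ≡ 0
countB-false []                       = refl
countB-false (px≡false ∷ rest) rewrite px≡false = countB-false rest

countB-const∧ : (c : Bool) (p : A → Bool) (xs : List A) →
                countB (λ x → c ∧ p x) xs ≡ (if c then countB p xs else 0)
countB-const∧ true  p xs = refl
countB-const∧ false p xs = countB-false (All.universal (λ _ → refl) xs)

countB-∧const : (c : Bool) (p : A → Bool) (xs : List A) →
                countB (λ x → p x ∧ c) xs ≡ (if c then countB p xs else 0)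
countB-∧const c p xs = trans (countB-cong (λ x → ∧-comm (p x) c) xs) (countB-const∧ c p xs)

countB-true : (xs : List A) → countB (λ _ → true) xs ≡ length xs
countB-true []       = refl
countB-true (x ∷ xs) = cong suc (countB-true xs)

countB-split : (p q : A → Bool) (xs : List A) →
               countB p xs ≡ countB (λ x → p x ∧ q x) xs + countB (λ x → p x ∧ not (q x)) xs
countB-split p q []       = refl
countB-split p q (x ∷ xs) with p x | q x
... | true  | true  = cong suc (countB-split p q xs)
... | true  | false = trans (cong suc (countB-split p q xs)) (sym (+-suc _ _))
... | false | _     = countB-split p q xs

sum-if : (c : A → Bool) (m : ℕ) (xs : List A) → sum (map (λ x → if c x then m else 0) xs) ≡ countB c xs * m
sum-if c m []       = refl
sum-if c m (x ∷ xs) with c x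
... | true  = cong (m +_) (sum-if c m xs)
... | false = sum-if c m xs

sum-congᴬ : {f g : A → ℕ} {xs : List A} → All (λ x → f x ≡ g x) xs → sum (map f xs) ≡ sum (map g xs)
sum-congᴬ eqs = cong sum (map-cong-local eqs)

not-∨ : ∀ a b → not (a ∨ b) ≡ not a ∧ not b
not-∨ true  b = refl
not-∨ false b = refl

∧-swap-under : (a b c : Bool) → (b ≡ true → a ≡ c) → a ∧ b ≡ b ∧ c
∧-swap-under a true  c a≡c = trans (∧-identityʳ a) (a≡c refl)
∧-swap-under a false c _   = ∧-zeroʳ a

any-++ : (f : A → Bool) (xs ys : List A) → any f (xs ++ ys) ≡ any f xs ∨ any f ys
any-++ f []       ys = refl
any-++ f (x ∷ xs) ys = trans (cong (f x ∨_) (any-++ f xs ys)) (sym (∨-assoc (f x) _ _))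

any-map : (f : B → Bool) (g : A → B) (xs : List A) → any f (map g xs) ≡ any (f ∘ g) xs
any-map f g []       = refl
any-map f g (x ∷ xs) = cong (f (g x) ∨_) (any-map f g xs)

any-concatMap : (f : B → Bool) (g : A → List B) (xs : List A) → any f (concatMap g xs) ≡ any (any f ∘ g) xs
any-concatMap f g []       = refl
any-concatMap f g (x ∷ xs) = trans (any-++ f (g x) (concatMap g xs)) (cong (any f (g x) ∨_) (any-concatMap f g xs))

any-congᴬ : {f g : A → Bool} {xs : List A} → All (λ x → f x ≡ g x) xs → any f xs ≡ any g xs
any-congᴬ []          = refl
any-congᴬ (eq ∷ eqs) = cong₂ _∨_ eq (any-congᴬ eqs)

any-cong : {f g : A → Bool} → (∀ x → f x ≡ g x) → (xs : List A) → any f xs ≡ any g xs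
any-cong f≗g xs = any-congᴬ (All.universal f≗g xs)

any-false : {f : A → Bool} (xs : List A) → (∀ x → f x ≡ false) → any f xs ≡ false
any-false []       fx≡false = refl
any-false (x ∷ xs) fx≡false rewrite fx≡false x = any-false xs fx≡false

any-∨ : (f g : A → Bool) (xs : List A) → any f xs ∨ any g xs ≡ any (λ x → f x ∨ g x) xs
any-∨ f g []       = refl
any-∨ f g (x ∷ xs) = trans (interchange (f x) _ (g x) _) (cong ((f x ∨ g x) ∨_) (any-∨ f g xs))
  where
  interchange : ∀ a b c d → (a ∨ b) ∨ (c ∨ d) ≡ (a ∨ c) ∨ (b ∨ d)
  interchange true  b     c     d = refl
  interchange false true  true  d = refl
  interchange false true  false d = refl
  interchange false false c     d = refl

any-swap : (f : A → B → Bool) (xs : List A) (ys : List B) →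
           any (λ x → any (f x) ys) xs ≡ any (λ y → any (λ x → f x y) xs) ys
any-swap f []       ys = sym (any-false ys (λ _ → refl))
any-swap f (x ∷ xs) ys = trans (cong (any (f x) ys ∨_) (any-swap f xs ys)) (any-∨ (f x) _ ys)

any-const∧ : (c : Bool) (f : A → Bool) (xs : List A) → any (λ x → c ∧ f x) xs ≡ c ∧ any f xs
any-const∧ true  f xs = refl
any-const∧ false f xs = any-false xs (λ _ → refl)

any-∧const : (c : Bool) (f : A → Bool) (xs : List A) → any (λ x → f x ∧ c) xs ≡ any f xs ∧ c
any-∧const c f xs = trans (any-cong (λ x → ∧-comm (f x) c) xs) (trans (any-const∧ c f xs) (∧-comm c _))

all-not : (f : A → Bool) (xs : List A) → all (not ∘ f) xs ≡ not (any f xs)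
all-not f []       = refl
all-not f (x ∷ xs) with f x
... | true  = refl
... | false = all-not f xs

all-++ : (f : A → Bool) (xs ys : List A) → all f (xs ++ ys) ≡ all f xs ∧ all f ys
all-++ f []       ys = refl
all-++ f (x ∷ xs) ys with f x
... | true  = all-++ f xs ys
... | false = refl

all-cong : {f g : A → Bool} → (∀ x → f x ≡ g x) → (xs : List A) → all f xs ≡ all g xs
all-cong f≗g []       = refl
all-cong f≗g (x ∷ xs) = cong₂ _∧_ (f≗g x) (all-cong f≗g xs)

all-∧ : (f g : A → Bool) (xs : List A) → all f xs ∧ all g xs ≡ all (λ x → f x ∧ g x) xs
all-∧ f g []       = refl
all-∧ f g (x ∷ xs) with f x | g x
... | true  | true  = all-∧ f g xs
... | true  | false = ∧-zeroʳ (all f xs)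
... | false | _     = refl

all-true : (xs : List A) → all (λ _ → true) xs ≡ true
all-true []       = refl
all-true (_ ∷ xs) = all-true xs

anyPair : (A → A → Bool) → List A → Bool
anyPair g []      = false
anyPair g (a ∷ l) = any (g a) l ∨ anyPair g l

allPairsᵇ : (A → A → Bool) → List A → Bool
allPairsᵇ ok []      = true
allPairsᵇ ok (a ∷ l) = all (ok a) l ∧ allPairsᵇ ok l

not-anyPair : (g : A → A → Bool) (l : List A) → not (anyPair g l) ≡ allPairsᵇ (λ a b → not (g a b)) l
not-anyPair g []      = refl
not-anyPair g (a ∷ l) =
  trans (not-∨ (any (g a) l) _) (cong₂ _∧_ (sym (all-not (g a) l)) (not-anyPair g l))

allPairsᵇ-cong : {f g : A → A → Bool} → (∀ a b → f a b ≡ g a b) → (l : List A) → allPairsᵇ f l ≡ allPairsᵇ g l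
allPairsᵇ-cong f≗g []      = refl
allPairsᵇ-cong f≗g (a ∷ l) = cong₂ _∧_ (all-cong (f≗g a) l) (allPairsᵇ-cong f≗g l)

allPairsᵇ-sound : (ok : A → A → Bool) (l : List A) → T (allPairsᵇ ok l) → AllPairs (λ a b → T (ok a b)) l
allPairsᵇ-sound ok []      _ = []
allPairsᵇ-sound ok (a ∷ l) t =
  let head , rest = Equivalence.to T-∧ t in all⁺ (ok a) l head ∷ allPairsᵇ-sound ok l rest

anyPair-congᴾ : {P : A → A → Set} {f g : A → A → Bool} → (∀ a b → P a b → f a b ≡ g a b) →
                {l : List A} → AllPairs P l → anyPair f l ≡ anyPair g l
anyPair-congᴾ f≗g []           = refl
anyPair-congᴾ f≗g (Pa ∷ Prest) = cong₂ _∨_ (any-congᴬ (All.map (f≗g _ _) Pa)) (anyPair-congᴾ f≗g Prest)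

anyPair-map : (g : B → B → Bool) (f : A → B) (l : List A) → anyPair g (map f l) ≡ anyPair (λ a b → g (f a) (f b)) l
anyPair-map g f []      = refl
anyPair-map g f (a ∷ l) = cong₂ _∨_ (any-map (g (f a)) f l) (anyPair-map g f l)

any-subseqs≡anyPair : (f : List A → Bool) → (∀ p → length p ≢ 2 → f p ≡ false) → (l : List A) →
                      any f (subseqs l) ≡ anyPair (λ a b → f (a ∷ b ∷ [])) l
any-subseqs≡anyPair {A = A} f f-pairs []      = trans (∨-identityʳ _) (f-pairs [] (λ ()))
any-subseqs≡anyPair {A = A} f f-pairs (x ∷ l) =
  trans (any-subseqs-∷ f x l) (cong₂ _∨_ (through x l) (any-subseqs≡anyPair f f-pairs l))
  where
  any-subseqs-∷ : (g : List A → Bool) (x : A) (l : List A) →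
                  any g (subseqs (x ∷ l)) ≡ any (g ∘ (x ∷_)) (subseqs l) ∨ any g (subseqs l)
  any-subseqs-∷ g x l = trans (any-++ g (map (x ∷_) (subseqs l)) (subseqs l))
                              (cong (_∨ any g (subseqs l)) (any-map g (x ∷_) (subseqs l)))

  only-[] : (g : List A → Bool) → (∀ z q → g (z ∷ q) ≡ false) → (l : List A) → any g (subseqs l) ≡ g []
  only-[] g g-nil []      = ∨-identityʳ (g [])
  only-[] g g-nil (z ∷ l) = trans (any-subseqs-∷ g z l)
                                  (cong₂ _∨_ (any-false (subseqs l) (g-nil z)) (only-[] g g-nil l))

  through : (x : A) (l : List A) → any (f ∘ (x ∷_)) (subseqs l) ≡ any (λ b → f (x ∷ b ∷ [])) l
  through x []      = trans (∨-identityʳ _) (f-pairs (x ∷ []) (λ ()))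
  through x (y ∷ l) = trans (any-subseqs-∷ (f ∘ (x ∷_)) y l)
    (cong₂ _∨_ (only-[] (f ∘ (x ∷_) ∘ (y ∷_)) (λ z q → f-pairs (x ∷ y ∷ z ∷ q) (λ ())) l) (through x l))

subseqs⇒⊆ : {p l : List A} → p ∈ subseqs l → p ⊆ l
subseqs⇒⊆ {l = []}    (here refl) = []
subseqs⇒⊆ {l = x ∷ l} p∈ with ∈-++⁻ (map (x ∷_) (subseqs l)) p∈
... | inj₂ p∈′ = x ∷ʳ subseqs⇒⊆ p∈′
... | inj₁ p∈′ with ∈-map⁻ (x ∷_) p∈′
...   | q , q∈ , refl = refl ∷ subseqs⇒⊆ q∈

subseqs-map : (f : A → B) (l : List A) → subseqs (map f l) ≡ map (map f) (subseqs l)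
subseqs-map f []      = refl
subseqs-map f (x ∷ l) = begin
  map (f x ∷_) (subseqs (map f l)) ++ subseqs (map f l)
    ≡⟨ cong (λ S → map (f x ∷_) S ++ S) (subseqs-map f l) ⟩
  map (f x ∷_) (map (map f) S) ++ map (map f) S
    ≡⟨ cong (_++ map (map f) S) (trans (sym (map-∘ S)) (map-∘ S)) ⟩
  map (map f) (map (x ∷_) S) ++ map (map f) S
    ≡⟨ sym (map-++ (map f) (map (x ∷_) S) S) ⟩
  map (map f) (subseqs (x ∷ l)) ∎
  where open ≡-Reasoning
        S = subseqs l

AllPairs-resp-⊆ : {R : A → A → Set} {xs ys : List A} → xs ⊆ ys → AllPairs R ys → AllPairs R xs
AllPairs-resp-⊆ []          []         = []
AllPairs-resp-⊆ (_ ∷ʳ xs⊆)  (_ ∷ Rys)  = AllPairs-resp-⊆ xs⊆ Rys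
AllPairs-resp-⊆ (refl ∷ xs⊆) (Ry ∷ Rys) = All-resp-⊆ xs⊆ Ry ∷ AllPairs-resp-⊆ xs⊆ Rys

AllPairs-mapWith∈ : {R S : A → A → Set} {v : List A} → AllPairs R v →
                    (∀ {a b} → a ∈ v → b ∈ v → R a b → S a b) → AllPairs S v
AllPairs-mapWith∈ []           R⇒S = []
AllPairs-mapWith∈ (Ra ∷ Rrest) R⇒S =
  All.tabulate (λ b∈ → R⇒S (here refl) (there b∈) (All.lookup Ra b∈))
  ∷ AllPairs-mapWith∈ Rrest (λ a∈ b∈ → R⇒S (there a∈) (there b∈))

-- Reductions of sequences and words

<ᵇ-true : ∀ {m n} → m < n → (m <ᵇ n) ≡ true
<ᵇ-true {m} {n} = dec-true (m <? n)

<ᵇ-false : ∀ {m n} → ¬ m < n → (m <ᵇ n) ≡ false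
<ᵇ-false {m} {n} = dec-false (m <? n)

≡ᵇ-refl : ∀ n → (n ≡ᵇ n) ≡ true
≡ᵇ-refl n = dec-true (n ≟ n) refl

≡ᵇ-false : ∀ {m n} → m ≢ n → (m ≡ᵇ n) ≡ false
≡ᵇ-false {m} {n} = dec-false (m ≟ n)

≢ᵇ⇒≢ : ∀ m n → T (not (m ≡ᵇ n)) → m ≢ n
≢ᵇ⇒≢ m n m≢ᵇn m≡n = subst T (Equivalence.to T-not-≡ m≢ᵇn) (≡⇒≡ᵇ m n m≡n)

redP-< : ∀ {s t} → s < t → redP (s ∷ t ∷ []) ≡ 1 ∷ 2 ∷ []
redP-< {s} {t} s<t
  rewrite <ᵇ-false (<-irrefl (refl {x = s})) | <ᵇ-false (<-asym s<t)
        | <ᵇ-true s<t | <ᵇ-false (<-irrefl (refl {x = t})) = refl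

redP-> : ∀ {s t} → t < s → redP (s ∷ t ∷ []) ≡ 2 ∷ 1 ∷ []
redP-> {s} {t} t<s
  rewrite <ᵇ-false (<-irrefl (refl {x = s})) | <ᵇ-false (<-asym t<s)
        | <ᵇ-true t<s | <ᵇ-false (<-irrefl (refl {x = t})) = refl

length-redP : (s : List ℕ) → length (redP s) ≡ length s
length-redP s = length-map _ s

-- `redW s` unfolds to `map (rank s) s`.
rank : List ℕ → ℕ → ℕ
rank s x = length (deduplicate _≟_ (filter (_<? x) s))

rank-of : (s : List ℕ) (x : ℕ) {l : List ℕ} → filter (_<? x) s ≡ l → rank s x ≡ length (deduplicate _≟_ l)
rank-of s x = cong (length ∘ deduplicate _≟_)

redW-< : ∀ {x y} → x < y → redW (x ∷ y ∷ []) ≡ 0 ∷ 1 ∷ []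
redW-< {x} {y} x<y = cong₂ (λ a b → a ∷ b ∷ [])
  (rank-of _ x (trans (filter-reject (_<? x) (<-irrefl refl)) (filter-reject (_<? x) (<-asym x<y))))
  (rank-of _ y (trans (filter-accept (_<? y) x<y) (cong (x ∷_) (filter-reject (_<? y) (<-irrefl refl)))))

redW-> : ∀ {x y} → y < x → redW (x ∷ y ∷ []) ≡ 1 ∷ 0 ∷ []
redW-> {x} {y} y<x = cong₂ (λ a b → a ∷ b ∷ [])
  (rank-of _ x (trans (filter-reject (_<? x) (<-irrefl refl)) (filter-accept (_<? x) y<x)))
  (rank-of _ y (trans (filter-reject (_<? y) (<-asym y<x)) (filter-reject (_<? y) (<-irrefl refl))))

redW-≡ : ∀ x → redW (x ∷ x ∷ []) ≡ 0 ∷ 0 ∷ []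
redW-≡ x = cong₂ (λ a b → a ∷ b ∷ []) below-x below-x
  where
  below-x : rank (x ∷ x ∷ []) x ≡ 0
  below-x = rank-of _ x (trans (filter-reject (_<? x) (<-irrefl refl)) (filter-reject (_<? x) (<-irrefl refl)))

redW-constant : {v : List ℕ} → AllPairs _≡_ v → redW v ≡ replicate (length v) 0
redW-constant {v} v-const = trans (map-cong-local (All.tabulate rank≡0)) (map-const v)
  where
  equal-to : ∀ {x} {v} → AllPairs _≡_ v → x ∈ v → All (_≡ x) v
  equal-to (x≡ ∷ _)      (here refl) = refl ∷ All.map sym x≡
  equal-to (x≡ ∷ v-const) (there x∈) = All.lookup x≡ x∈ ∷ equal-to v-const x∈

  rank≡0 : ∀ {x} → x ∈ v → rank v x ≡ 0
  rank≡0 {x} x∈ = rank-of v x (filter-none (_<? x) (All.map (λ { refl → <-irrefl refl }) (equal-to v-const x∈)))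

  map-const : (v : List ℕ) → map (λ _ → 0) v ≡ replicate (length v) 0
  map-const []      = refl
  map-const (_ ∷ v) = cong (0 ∷_) (map-const v)

redW-increasing : {v : List ℕ} → AllPairs _<_ v → redW v ≡ upTo (length v)
redW-increasing {[]}    []                = refl
redW-increasing {a ∷ v} (a<rest ∷ v-incr) = cong₂ _∷_ rank-a ranks-rest
  where
  rank-a : rank (a ∷ v) a ≡ 0
  rank-a = rank-of (a ∷ v) a (trans (filter-reject (_<? a) (<-irrefl refl))
                          (filter-none (_<? a) (All.map (λ a<y y<a → <-asym a<y y<a) a<rest)))

  rank-rest : ∀ {x} → x ∈ v → rank (a ∷ v) x ≡ suc (rank v x)
  rank-rest {x} x∈ = trans (rank-of (a ∷ v) x (filter-accept (_<? x) (All.lookup a<rest x∈)))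
    (cong (suc ∘ length) (filter-all (λ y → ¬? (a ≟ y))
      (All.deduplicate⁺ _≟_ (All.filter⁺ (_<? x) (All.map (λ a<y a≡y → <-irrefl a≡y a<y) a<rest)))))

  ranks-rest : map (rank (a ∷ v)) v ≡ applyUpTo suc (length v)
  ranks-rest = begin
    map (rank (a ∷ v)) v        ≡⟨ map-cong-local (All.tabulate rank-rest) ⟩
    map (suc ∘ rank v) v        ≡⟨ map-∘ v ⟩
    map suc (redW v)            ≡⟨ cong (map suc) (redW-increasing v-incr) ⟩
    map suc (upTo (length v))   ≡⟨ map-upTo suc (length v) ⟩
    applyUpTo suc (length v)    ∎
    where open ≡-Reasoning

module _ {P Q : Pred A 0ℓ} (P? : Decidable P) (Q? : Decidable Q) (P⇒Q : ∀ {y} → P y → Q y) where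

  length-filter-mono : (xs : List A) → length (filter P? xs) ≤ length (filter Q? xs)
  length-filter-mono xs = length-mono-≤ (filter⁺ P? Q? (λ { refl → P⇒Q }) (⊆-refl {x = xs}))

  length-filter-strict : ∀ {x xs} → x ∈ xs → ¬ P x → Q x → length (filter P? xs) < length (filter Q? xs)
  length-filter-strict {x} {_ ∷ xs} (here refl) ¬Px Qx with P? x | Q? x
  ... | yes Px | _      = ⊥-elim (¬Px Px)
  ... | no _   | yes _  = s≤s (length-filter-mono xs)
  ... | no _   | no ¬Qx = ⊥-elim (¬Qx Qx)
  length-filter-strict {xs = y ∷ _} (there x∈) ¬Px Qx with P? y | Q? y
  ... | yes _  | yes _  = s≤s (length-filter-strict x∈ ¬Px Qx)
  ... | yes Py | no ¬Qy = ⊥-elim (¬Qy (P⇒Q Py))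
  ... | no _   | yes _  = m<n⇒m<1+n (length-filter-strict x∈ ¬Px Qx)
  ... | no _   | no _   = length-filter-strict x∈ ¬Px Qx

deduplicate-unique : {l : List ℕ} → Unique l → deduplicate _≟_ l ≡ l
deduplicate-unique {[]}    []            = refl
deduplicate-unique {x ∷ l} (x∉ ∷ l-uniq) =
  cong (x ∷_) (trans (cong (filter (λ y → ¬? (x ≟ y))) (deduplicate-unique l-uniq))
                     (filter-all (λ y → ¬? (x ≟ y)) x∉))

rank-unique : {v : List ℕ} → Unique v → ∀ x → rank v x ≡ length (filter (_<? x) v)
rank-unique v-uniq x = cong length (deduplicate-unique (Unique.filter⁺ (_<? x) v-uniq))

rank-bound : (v : List ℕ) → ∀ {x} → x ∈ v → rank v x < length v
rank-bound v {x} x∈ = ≤-<-trans (length-deduplicate _≟_ (filter (_<? x) v))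
                                (filter-notAll (_<? x) v (Any.map (λ { refl → <-irrefl refl }) x∈))

rank-strictMono : {v : List ℕ} → Unique v → ∀ {x y} → x ∈ v → x < y → rank v x < rank v y
rank-strictMono {v} v-uniq {x} {y} x∈ x<y =
  subst₂ _<_ (sym (rank-unique v-uniq x)) (sym (rank-unique v-uniq y))
         (length-filter-strict (_<? x) (_<? y) (λ z<x → <-trans z<x x<y) x∈ (<-irrefl refl) x<y)

rank-injective : {v : List ℕ} → Unique v → ∀ {a b} → a ∈ v → b ∈ v → a ≢ b → rank v a ≢ rank v b
rank-injective v-uniq {a} {b} a∈ b∈ a≢b with <-cmp a b
... | tri< a<b _ _ = <⇒≢ (rank-strictMono v-uniq a∈ a<b)
... | tri≈ _ a≡b _ = ⊥-elim (a≢b a≡b)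
... | tri> _ _ b<a = ≢-sym (<⇒≢ (rank-strictMono v-uniq b∈ b<a))

∈-words : (L : List ℕ) {xs : List ℕ} → All (_∈ L) xs → xs ∈ words (length xs) L
∈-words L {[]}     []           = here refl
∈-words L {x ∷ xs} (x∈ ∷ xs⊆L) =
  ∈-concat⁺′ (∈-map⁺ (x ∷_) (∈-words L xs⊆L)) (∈-map⁺ (λ a → map (a ∷_) (words (length xs) L)) x∈)

redW-injective : {v : List ℕ} → Unique v → redW v ∈ Dwords (length v)
redW-injective {v} v-uniq = ∈-filter⁺ unique? redW∈words redW-unique
  where
  redW∈words : redW v ∈ words (length v) (upTo (length v))
  redW∈words = subst (λ n → redW v ∈ words n (upTo (length v))) (length-map (rank v) v)
                     (∈-words (upTo (length v)) (All.map⁺ (All.tabulate (∈-upTo⁺ ∘ rank-bound v))))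

  redW-unique : Unique (redW v)
  redW-unique = AllPairs.map⁺ (AllPairs-mapWith∈ v-uniq (rank-injective v-uniq))

-- Patterns of product shape

map-proj₁-zip : (σ w : List ℕ) → length σ ≡ length w → map proj₁ (zip σ w) ≡ σ
map-proj₁-zip []      []      _        = refl
map-proj₁-zip (x ∷ σ) (_ ∷ w) |σ|≡|w| = cong (x ∷_) (map-proj₁-zip σ w (suc-injective |σ|≡|w|))

map-proj₂-zip : (σ w : List ℕ) → length σ ≡ length w → map proj₂ (zip σ w) ≡ w
map-proj₂-zip []      []      _        = refl
map-proj₂-zip (_ ∷ σ) (y ∷ w) |σ|≡|w| = cong (y ∷_) (map-proj₂-zip σ w (suc-injective |σ|≡|w|))

_∈ᵇ_ : List ℕ → List (List ℕ) → Bool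
u ∈ᵇ U = any (eqL u) U

∈ᵇ⇒∈ : ∀ {u U} → u ∈ᵇ U ≡ true → u ∈ U
∈ᵇ⇒∈ {u} {U} u∈ᵇU = Any.map toWitness (any⁻ (eqL u) U (Equivalence.from T-≡ u∈ᵇU))

∈⇒∈ᵇ : ∀ {u U} → u ∈ U → u ∈ᵇ U ≡ true
∈⇒∈ᵇ {u} u∈U = Equivalence.to T-≡ (any⁺ (eqL u) (Any.map fromWitness u∈U))

∈ᵇ-length : ∀ {u U j} → All (λ τ → length τ ≡ j) U → u ∈ᵇ U ≡ true → length u ≡ j
∈ᵇ-length |U|≡j u∈ᵇU = All.lookup |U|≡j (∈ᵇ⇒∈ u∈ᵇU)

∉ᵇ-length : ∀ {u U j} → All (λ τ → length τ ≡ j) U → length u ≢ j → u ∈ᵇ U ≡ false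
∉ᵇ-length {u} {U} |U|≡j |u|≢j with u ∈ᵇ U in u∈ᵇU
... | true  = ⊥-elim (|u|≢j (∈ᵇ-length |U|≡j u∈ᵇU))
... | false = refl

_⊗_ : List (List ℕ) → List (List ℕ) → List Pattern
Υ ⊗ U = concatMap (λ τ → map (τ ,_) U) Υ

map-pair≡⊗-singleton : (u : List ℕ) (Υ : List (List ℕ)) → map (λ τ → τ , u) Υ ≡ Υ ⊗ (u ∷ [])
map-pair≡⊗-singleton u []      = refl
map-pair≡⊗-singleton u (τ ∷ Υ) = cong ((τ , u) ∷_) (map-pair≡⊗-singleton u Υ)

occurs⊗ : List (List ℕ) → List (List ℕ) → List (ℕ × ℕ) → Bool
occurs⊗ Υ U p = (redP (map proj₁ p) ∈ᵇ Υ) ∧ (redW (map proj₂ p) ∈ᵇ U)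

biAvoids-⊗ : (Υ U : List (List ℕ)) (σ w : List ℕ) →
             biAvoids (Υ ⊗ U) (σ , w) ≡ not (any (occurs⊗ Υ U) (subseqs (zip σ w)))
biAvoids-⊗ Υ U σ w = begin
  biAvoids (Υ ⊗ U) (σ , w)
    ≡⟨ all-not (λ γ → biOccurs γ (σ , w)) (Υ ⊗ U) ⟩
  not (any (λ γ → biOccurs γ (σ , w)) (Υ ⊗ U))
    ≡⟨ cong not (any-concatMap _ _ Υ) ⟩
  not (any (λ τ → any (λ γ → biOccurs γ (σ , w)) (map (τ ,_) U)) Υ)
    ≡⟨ cong not (any-cong (λ τ → trans (any-map _ (τ ,_) U) (any-swap _ U P)) Υ) ⟩
  not (any (λ τ → any (λ p → any (λ u → is τ p ∧ isW u p) U) P) Υ)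
    ≡⟨ cong not (any-cong (λ τ → any-cong (λ p → any-const∧ (is τ p) (λ u → isW u p) U) P) Υ) ⟩
  not (any (λ τ → any (λ p → is τ p ∧ (redW (map proj₂ p) ∈ᵇ U)) P) Υ)
    ≡⟨ cong not (any-swap _ Υ P) ⟩
  not (any (λ p → any (λ τ → is τ p ∧ (redW (map proj₂ p) ∈ᵇ U)) Υ) P)
    ≡⟨ cong not (any-cong (λ p → any-∧const _ (λ τ → is τ p) Υ) P) ⟩
  not (any (occurs⊗ Υ U) P) ∎
  where
  open ≡-Reasoning
  P = subseqs (zip σ w)
  is : List ℕ → List (ℕ × ℕ) → Bool
  is τ p = eqL (redP (map proj₁ p)) τ
  isW : List ℕ → List (ℕ × ℕ) → Bool
  isW u p = eqL (redW (map proj₂ p)) u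

biAvoids-⊗≡avoids : {Υ U : List (List ℕ)} {j : ℕ} → All (λ τ → length τ ≡ j) Υ →
                    {σ w : List ℕ} → length σ ≡ length w →
                    (∀ {v} → v ⊆ w → length v ≡ j → redW v ∈ U) →
                    biAvoids (Υ ⊗ U) (σ , w) ≡ not (occursP Υ σ)
biAvoids-⊗≡avoids {Υ} {U} {j} |Υ|≡j {σ} {w} |σ|≡|w| w-reduces-into-U =
  trans (biAvoids-⊗ Υ U σ w) (cong not (begin
    any (occurs⊗ Υ U) (subseqs (zip σ w))
      ≡⟨ any-congᴬ (All.tabulate occurs⊗≡occurs) ⟩
    any (λ p → redP (map proj₁ p) ∈ᵇ Υ) (subseqs (zip σ w))
      ≡⟨ sym (any-map _ (map proj₁) (subseqs (zip σ w))) ⟩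
    any (λ q → redP q ∈ᵇ Υ) (map (map proj₁) (subseqs (zip σ w)))
      ≡⟨ cong (any _) (sym (subseqs-map proj₁ (zip σ w))) ⟩
    any (λ q → redP q ∈ᵇ Υ) (subseqs (map proj₁ (zip σ w)))
      ≡⟨ cong (any _ ∘ subseqs) (map-proj₁-zip σ w |σ|≡|w|) ⟩
    occursP Υ σ ∎))
  where
  open ≡-Reasoning
  ∧-absorb : (a b : Bool) → (a ≡ true → b ≡ true) → a ∧ b ≡ a
  ∧-absorb true  b a⇒b = a⇒b refl
  ∧-absorb false b _   = refl

  occurs⊗≡occurs : ∀ {p} → p ∈ subseqs (zip σ w) → occurs⊗ Υ U p ≡ redP (map proj₁ p) ∈ᵇ Υ
  occurs⊗≡occurs {p} p∈ = ∧-absorb _ _ λ τ∈Υ → ∈⇒∈ᵇ (w-reduces-into-U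
    (subst (map proj₂ p ⊆_) (map-proj₂-zip σ w |σ|≡|w|) (Sublist.map⁺ proj₂ (subseqs⇒⊆ p∈)))
    (begin
      length (map proj₂ p)         ≡⟨ length-map proj₂ p ⟩
      length p                     ≡⟨ sym (length-map proj₁ p) ⟩
      length (map proj₁ p)         ≡⟨ sym (length-redP (map proj₁ p)) ⟩
      length (redP (map proj₁ p))  ≡⟨ ∈ᵇ-length |Υ|≡j τ∈Υ ⟩
      j ∎))

S₂ : List (List ℕ)
S₂ = (1 ∷ 2 ∷ []) ∷ (2 ∷ 1 ∷ []) ∷ []

redP-pair∈S₂ : ∀ {s t} → s ≢ t → redP (s ∷ t ∷ []) ∈ᵇ S₂ ≡ true
redP-pair∈S₂ {s} {t} s≢t with <-cmp s t
... | tri< s<t _ _ = ∈⇒∈ᵇ {redP (s ∷ t ∷ [])} {S₂} (here (redP-< s<t))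
... | tri≈ _ s≡t _ = ⊥-elim (s≢t s≡t)
... | tri> _ _ t<s = ∈⇒∈ᵇ {redP (s ∷ t ∷ [])} {S₂} (there (here (redP-> t<s)))

biAvoids-S₂⊗ : (V : List (List ℕ)) {σ w : List ℕ} → Unique σ → length σ ≡ length w →
               biAvoids (S₂ ⊗ V) (σ , w) ≡ allPairsᵇ (λ x y → not (redW (x ∷ y ∷ []) ∈ᵇ V)) w
biAvoids-S₂⊗ V {σ} {w} σ-uniq |σ|≡|w| = begin
  biAvoids (S₂ ⊗ V) (σ , w)
    ≡⟨ biAvoids-⊗ S₂ V σ w ⟩
  not (any (occurs⊗ S₂ V) (subseqs (zip σ w)))
    ≡⟨ cong not (any-subseqs≡anyPair _ only-pairs (zip σ w)) ⟩
  not (anyPair (λ a b → occurs⊗ S₂ V (a ∷ b ∷ [])) (zip σ w))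
    ≡⟨ cong not (anyPair-congᴾ distinct-pair (AllPairs.map⁻ σ-uniq′)) ⟩
  not (anyPair (λ a b → bad (proj₂ a) (proj₂ b)) (zip σ w))
    ≡⟨ cong not (sym (anyPair-map bad proj₂ (zip σ w))) ⟩
  not (anyPair bad (map proj₂ (zip σ w)))
    ≡⟨ cong (not ∘ anyPair bad) (map-proj₂-zip σ w |σ|≡|w|) ⟩
  not (anyPair bad w)
    ≡⟨ not-anyPair bad w ⟩
  allPairsᵇ (λ x y → not (bad x y)) w ∎
  where
  open ≡-Reasoning
  bad : ℕ → ℕ → Bool
  bad x y = redW (x ∷ y ∷ []) ∈ᵇ V

  σ-uniq′ : Unique (map proj₁ (zip σ w))
  σ-uniq′ = subst Unique (sym (map-proj₁-zip σ w |σ|≡|w|)) σ-uniq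

  only-pairs : ∀ p → length p ≢ 2 → occurs⊗ S₂ V p ≡ false
  only-pairs p |p|≢2 = cong (_∧ (redW (map proj₂ p) ∈ᵇ V)) (∉ᵇ-length {redP (map proj₁ p)} {S₂} (refl ∷ refl ∷ [])
    (|p|≢2 ∘ trans (sym (trans (length-redP (map proj₁ p)) (length-map proj₁ p)))))

  distinct-pair : ∀ a b → proj₁ a ≢ proj₁ b → occurs⊗ S₂ V (a ∷ b ∷ []) ≡ bad (proj₂ a) (proj₂ b)
  distinct-pair (s , x) (t , y) s≢t = cong (_∧ bad x y) (redP-pair∈S₂ s≢t)

-- Γ₁ j Υ, Γ₂ j Υ and Γ₃ j Υ are, definitionally, Υ₀ j Υ ++ S₂ ⊗ nonconstant₂,
-- Υinc j Υ ++ S₂ ⊗ nonincreasing₂ and Υ ⊗ Dwords j ++ S₂ ⊗ constant₂.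
nonconstant₂ nonincreasing₂ constant₂ : List (List ℕ)
nonconstant₂   = (0 ∷ 1 ∷ []) ∷ (1 ∷ 0 ∷ []) ∷ []
nonincreasing₂ = (1 ∷ 0 ∷ []) ∷ (0 ∷ 0 ∷ []) ∷ []
constant₂      = (0 ∷ 0 ∷ []) ∷ []

avoid-pair : (V : List (List ℕ)) (ok : ℕ → ℕ → Bool) →
             (∀ {x y} → x < y → not ((0 ∷ 1 ∷ []) ∈ᵇ V) ≡ ok x y) →
             (∀ x → not ((0 ∷ 0 ∷ []) ∈ᵇ V) ≡ ok x x) →
             (∀ {x y} → y < x → not ((1 ∷ 0 ∷ []) ∈ᵇ V) ≡ ok x y) →
             ∀ x y → not (redW (x ∷ y ∷ []) ∈ᵇ V) ≡ ok x y
avoid-pair V ok ok-< ok-≡ ok-> x y with <-cmp x y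
... | tri< x<y _ _ = trans (cong (λ r → not (r ∈ᵇ V)) (redW-< x<y)) (ok-< x<y)
... | tri≈ _ refl _ = trans (cong (λ r → not (r ∈ᵇ V)) (redW-≡ x)) (ok-≡ x)
... | tri> _ _ y<x = trans (cong (λ r → not (r ∈ᵇ V)) (redW-> y<x)) (ok-> y<x)

avoid-nonconstant₂ : ∀ x y → not (redW (x ∷ y ∷ []) ∈ᵇ nonconstant₂) ≡ (x ≡ᵇ y)
avoid-nonconstant₂ = avoid-pair nonconstant₂ _≡ᵇ_
  (λ x<y → sym (≡ᵇ-false (<⇒≢ x<y)))
  (λ x → sym (≡ᵇ-refl x))
  (λ y<x → sym (≡ᵇ-false (≢-sym (<⇒≢ y<x))))

avoid-nonincreasing₂ : ∀ x y → not (redW (x ∷ y ∷ []) ∈ᵇ nonincreasing₂) ≡ (x <ᵇ y)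
avoid-nonincreasing₂ = avoid-pair nonincreasing₂ _<ᵇ_
  (λ x<y → sym (<ᵇ-true x<y))
  (λ x → sym (<ᵇ-false (<-irrefl (refl {x = x}))))
  (λ y<x → sym (<ᵇ-false (<-asym y<x)))

avoid-constant₂ : ∀ x y → not (redW (x ∷ y ∷ []) ∈ᵇ constant₂) ≡ not (x ≡ᵇ y)
avoid-constant₂ = avoid-pair constant₂ (λ x y → not (x ≡ᵇ y))
  (λ x<y → cong not (sym (≡ᵇ-false (<⇒≢ x<y))))
  (λ x → cong not (sym (≡ᵇ-refl x)))
  (λ y<x → cong not (sym (≡ᵇ-false (≢-sym (<⇒≢ y<x)))))

-- Factorisation of the count

length-words : ∀ n (L : List ℕ) {w} → w ∈ words n L → length w ≡ n
length-words zero    L (here refl) = refl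
length-words (suc n) L w∈ with ∈-concat⁻′ (map (λ a → map (a ∷_) (words n L)) L) w∈
... | ws , w∈ws , ws∈ with ∈-map⁻ (λ a → map (a ∷_) (words n L)) ws∈
...   | a , _ , refl with ∈-map⁻ (a ∷_) w∈ws
...     | w′ , w′∈ , refl = cong suc (length-words n L w′∈)

∈-Sym⁻ : ∀ {n σ} → σ ∈ Sym n → Unique σ × length σ ≡ n
∈-Sym⁻ {n} σ∈ with ∈-filter⁻ unique? {xs = words n (applyUpTo suc n)} σ∈
... | σ∈words , σ-uniq = σ-uniq , length-words n _ σ∈words

AvC-factorises : (Γ : List Pattern) (good : List ℕ → Bool) (Υ : List (List ℕ)) (n k : ℕ) →
                 (∀ {σ w} → σ ∈ Sym n → w ∈ words n (upTo k) →
                    biAvoids Γ (σ , w) ≡ good w ∧ not (occursP Υ σ)) →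
                 AvC Γ n k ≡ AvP Υ n * countB good (words n (upTo k))
AvC-factorises Γ good Υ n k factorises = begin
  countB (biAvoids Γ) (concatMap (λ σ → map (σ ,_) W) (Sym n))
    ≡⟨ countB-concatMap (biAvoids Γ) _ (Sym n) ⟩
  sum (map (λ σ → countB (biAvoids Γ) (map (σ ,_) W)) (Sym n))
    ≡⟨ sum-congᴬ (All.tabulate per-σ) ⟩
  sum (map (λ σ → if avoids σ then countB good W else 0) (Sym n))
    ≡⟨ sum-if avoids _ (Sym n) ⟩
  AvP Υ n * countB good W ∎
  where
  open ≡-Reasoning
  W = words n (upTo k)

  avoids : List ℕ → Bool
  avoids σ = not (occursP Υ σ)

  per-σ : ∀ {σ} → σ ∈ Sym n → countB (biAvoids Γ) (map (σ ,_) W) ≡ (if avoids σ then countB good W else 0)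
  per-σ {σ} σ∈ = trans (countB-map (biAvoids Γ) (σ ,_) W)
                       (trans (countB-congᴬ (All.tabulate (factorises σ∈))) (countB-∧const (avoids σ) good W))

module _ {Υ : List (List ℕ)} (U V : List (List ℕ)) {j : ℕ} (|Υ|≡j : All (λ τ → length τ ≡ j) Υ)
         (ok : ℕ → ℕ → Bool) (avoid-V : ∀ x y → not (redW (x ∷ y ∷ []) ∈ᵇ V) ≡ ok x y)
         (ok⇒reduces-into-U : ∀ {v} → AllPairs (λ x y → T (ok x y)) v → length v ≡ j → redW v ∈ U)
         where

  biAvoids-⊗++S₂⊗ : {σ w : List ℕ} → Unique σ → length σ ≡ length w →
                    biAvoids (Υ ⊗ U ++ S₂ ⊗ V) (σ , w) ≡ allPairsᵇ ok w ∧ not (occursP Υ σ)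
  biAvoids-⊗++S₂⊗ {σ} {w} σ-uniq |σ|≡|w| = begin
    biAvoids (Υ ⊗ U ++ S₂ ⊗ V) (σ , w)
      ≡⟨ all-++ _ (Υ ⊗ U) (S₂ ⊗ V) ⟩
    biAvoids (Υ ⊗ U) (σ , w) ∧ biAvoids (S₂ ⊗ V) (σ , w)
      ≡⟨ cong (biAvoids (Υ ⊗ U) (σ , w) ∧_) (trans (biAvoids-S₂⊗ V σ-uniq |σ|≡|w|) (allPairsᵇ-cong avoid-V w)) ⟩
    biAvoids (Υ ⊗ U) (σ , w) ∧ allPairsᵇ ok w
      ≡⟨ ∧-swap-under _ (allPairsᵇ ok w) _ (λ w-ok → biAvoids-⊗≡avoids |Υ|≡j {σ} {w} |σ|≡|w|
           (λ v⊆w → ok⇒reduces-into-U (AllPairs-resp-⊆ v⊆w (allPairsᵇ-sound ok w (Equivalence.from T-≡ w-ok))))) ⟩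
    allPairsᵇ ok w ∧ not (occursP Υ σ) ∎
    where open ≡-Reasoning

  AvC-⊗++S₂⊗ : ∀ n k → AvC (Υ ⊗ U ++ S₂ ⊗ V) n k ≡ AvP Υ n * countB (allPairsᵇ ok) (words n (upTo k))
  AvC-⊗++S₂⊗ n k = AvC-factorises (Υ ⊗ U ++ S₂ ⊗ V) (allPairsᵇ ok) Υ n k λ {σ} {w} σ∈ w∈ →
    let σ-uniq , |σ|≡n = ∈-Sym⁻ σ∈ in
    biAvoids-⊗++S₂⊗ σ-uniq (trans |σ|≡n (sym (length-words n (upTo k) w∈)))

module _ (j : ℕ) {Υ : List (List ℕ)} (Υ⊆Sym : All (_∈ Sym j) Υ) (n k : ℕ) where

  private
    |Υ|≡j : All (λ τ → length τ ≡ j) Υ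
    |Υ|≡j = All.map (proj₂ ∘ ∈-Sym⁻) Υ⊆Sym

  AvC-Γ₁ : AvC (Γ₁ j Υ) n k ≡ AvP Υ n * countB (allPairsᵇ _≡ᵇ_) (words n (upTo k))
  AvC-Γ₁ = trans (cong (λ Γ → AvC (Γ ++ S₂ ⊗ nonconstant₂) n k) (map-pair≡⊗-singleton _ Υ))
                 (AvC-⊗++S₂⊗ (replicate j 0 ∷ []) nonconstant₂ |Υ|≡j _ avoid-nonconstant₂ reduces n k)
    where
    reduces : ∀ {v} → AllPairs (λ x y → T (x ≡ᵇ y)) v → length v ≡ j → redW v ∈ replicate j 0 ∷ []
    reduces v-const |v|≡j = here (trans (redW-constant (AllPairs.map (≡ᵇ⇒≡ _ _) v-const)) (cong (λ m → replicate m 0) |v|≡j))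

  AvC-Γ₂ : AvC (Γ₂ j Υ) n k ≡ AvP Υ n * countB (allPairsᵇ _<ᵇ_) (words n (upTo k))
  AvC-Γ₂ = trans (cong (λ Γ → AvC (Γ ++ S₂ ⊗ nonincreasing₂) n k) (map-pair≡⊗-singleton _ Υ))
                 (AvC-⊗++S₂⊗ (upTo j ∷ []) nonincreasing₂ |Υ|≡j _ avoid-nonincreasing₂ reduces n k)
    where
    reduces : ∀ {v} → AllPairs (λ x y → T (x <ᵇ y)) v → length v ≡ j → redW v ∈ upTo j ∷ []
    reduces v-incr |v|≡j = here (trans (redW-increasing (AllPairs.map (<ᵇ⇒< _ _) v-incr)) (cong upTo |v|≡j))

  AvC-Γ₃ : AvC (Γ₃ j Υ) n k ≡ AvP Υ n * countB (allPairsᵇ (λ x y → not (x ≡ᵇ y))) (words n (upTo k))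
  AvC-Γ₃ = AvC-⊗++S₂⊗ (Dwords j) constant₂ |Υ|≡j _ avoid-constant₂ reduces n k
    where
    reduces : ∀ {v} → AllPairs (λ x y → T (not (x ≡ᵇ y))) v → length v ≡ j → redW v ∈ Dwords j
    reduces v-inj |v|≡j = subst (λ m → redW _ ∈ Dwords m) |v|≡j (redW-injective (AllPairs.map (≢ᵇ⇒≢ _ _) v-inj))

-- Counting constant, increasing and injective words

-- Restricting the letters by `e` is what lets the first-letter recursion close up:
-- once the first letter is a, the others range over the letters y with e y ∧ ok a y.
countB-words-suc : (ok : ℕ → ℕ → Bool) (e : ℕ → Bool) (n : ℕ) (L : List ℕ) →
  countB (λ w → all e w ∧ allPairsᵇ ok w) (words (suc n) L) ≡
  sum (map (λ a → if e a then countB (λ w → all (λ y → e y ∧ ok a y) w ∧ allPairsᵇ ok w) (words n L) else 0) L)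
countB-words-suc ok e n L = begin
  countB good (concatMap (λ a → map (a ∷_) (words n L)) L)
    ≡⟨ countB-concatMap good _ L ⟩
  sum (map (λ a → countB good (map (a ∷_) (words n L))) L)
    ≡⟨ sum-congᴬ (All.universal (λ a → trans (countB-map good (a ∷_) (words n L)) (first-letter a)) L) ⟩
  sum (map (λ a → if e a then countB (λ w → all (λ y → e y ∧ ok a y) w ∧ allPairsᵇ ok w) (words n L) else 0) L) ∎
  where
  open ≡-Reasoning
  good : List ℕ → Bool
  good w = all e w ∧ allPairsᵇ ok w

  regroup : ∀ a b c d → (a ∧ b) ∧ (c ∧ d) ≡ a ∧ ((b ∧ c) ∧ d)
  regroup false b c d = refl
  regroup true  b c d = sym (∧-assoc b c d)

  first-letter : ∀ a → countB (good ∘ (a ∷_)) (words n L) ≡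
                       (if e a then countB (λ w → all (λ y → e y ∧ ok a y) w ∧ allPairsᵇ ok w) (words n L) else 0)
  first-letter a = trans (countB-cong (λ w → trans (regroup (e a) (all e w) (all (ok a) w) (allPairsᵇ ok w))
                                                   (cong (λ b → e a ∧ (b ∧ allPairsᵇ ok w)) (all-∧ e (ok a) w)))
                                      (words n L))
                         (countB-const∧ (e a) _ (words n L))

countB-∧≡ᵇ : {L : List ℕ} → Unique L → (e : ℕ → Bool) → ∀ {a} → a ∈ L → e a ≡ true →
             countB (λ y → e y ∧ (a ≡ᵇ y)) L ≡ 1
countB-∧≡ᵇ {x ∷ L} (x∉ ∷ _) e (here refl) ex rewrite ex | ≡ᵇ-refl x =
  cong suc (countB-false (All.map (λ {y} x≢y → trans (cong (e y ∧_) (≡ᵇ-false x≢y)) (∧-zeroʳ (e y))) x∉))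
countB-∧≡ᵇ {x ∷ L} (x∉ ∷ L-uniq) e {a} (there a∈) ea
  rewrite ≡ᵇ-false {a} {x} (λ a≡x → All.lookup x∉ a∈ (sym a≡x)) | ∧-zeroʳ (e x) = countB-∧≡ᵇ L-uniq e a∈ ea

countB-∧≢ᵇ : {L : List ℕ} → Unique L → (e : ℕ → Bool) → ∀ {a} → a ∈ L → e a ≡ true →
             countB (λ y → e y ∧ not (a ≡ᵇ y)) L ≡ pred (countB e L)
countB-∧≢ᵇ {L} L-uniq e {a} a∈ ea = sym (begin
  pred (countB e L)
    ≡⟨ cong pred (countB-split e (a ≡ᵇ_) L) ⟩
  pred (countB (λ y → e y ∧ (a ≡ᵇ y)) L + countB (λ y → e y ∧ not (a ≡ᵇ y)) L)
    ≡⟨ cong (λ m → pred (m + others)) (countB-∧≡ᵇ L-uniq e a∈ ea) ⟩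
  others ∎)
  where
  open ≡-Reasoning
  others = countB (λ y → e y ∧ not (a ≡ᵇ y)) L

mutual
  count-constant : {L : List ℕ} → Unique L → (e : ℕ → Bool) (n : ℕ) →
                   countB (λ w → all e w ∧ allPairsᵇ _≡ᵇ_ w) (words (suc n) L) ≡ countB e L
  count-constant {L} L-uniq e n = begin
    countB (λ w → all e w ∧ allPairsᵇ _≡ᵇ_ w) (words (suc n) L)
      ≡⟨ countB-words-suc _≡ᵇ_ e n L ⟩
    sum (map (λ a → if e a then constant-from a else 0) L)
      ≡⟨ sum-congᴬ (All.tabulate one-each) ⟩
    sum (map (λ a → if e a then 1 else 0) L)
      ≡⟨ sum-if e 1 L ⟩
    countB e L * 1
      ≡⟨ *-identityʳ _ ⟩
    countB e L ∎
    where
    open ≡-Reasoning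
    constant-from : ℕ → ℕ
    constant-from a = countB (λ w → all (λ y → e y ∧ (a ≡ᵇ y)) w ∧ allPairsᵇ _≡ᵇ_ w) (words n L)

    one-each : ∀ {a} → a ∈ L → (if e a then constant-from a else 0) ≡ (if e a then 1 else 0)
    one-each {a} a∈ with e a in ea
    ... | true  = count-constant-from L-uniq e a∈ ea n
    ... | false = refl

  count-constant-from : {L : List ℕ} → Unique L → (e : ℕ → Bool) → ∀ {a} → a ∈ L → e a ≡ true → (n : ℕ) →
                        countB (λ w → all (λ y → e y ∧ (a ≡ᵇ y)) w ∧ allPairsᵇ _≡ᵇ_ w) (words n L) ≡ 1
  count-constant-from L-uniq e a∈ ea zero    = refl
  count-constant-from L-uniq e a∈ ea (suc n) =
    trans (count-constant L-uniq _ n) (countB-∧≡ᵇ L-uniq e a∈ ea)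

hockey-stick : {L : List ℕ} → AllPairs _<_ L → (e : ℕ → Bool) (n : ℕ) →
               sum (map (λ a → if e a then countB (λ y → e y ∧ (a <ᵇ y)) L C n else 0) L) ≡ countB e L C suc n
hockey-stick {[]}    []               e n = refl
hockey-stick {x ∷ L} (x<L ∷ L-incr) e n = begin
  (if e x then above x (x ∷ L) C n else 0) + sum (map (λ a → if e a then above a (x ∷ L) C n else 0) L)
    ≡⟨ cong₂ _+_ (cong (λ m → if e x then m C n else 0) above-x)
                 (sum-congᴬ (All.map (λ {a} x<a → cong (λ m → if e a then m C n else 0) (above-a x<a)) x<L)) ⟩
  (if e x then countB e L C n else 0) + sum (map (λ a → if e a then above a L C n else 0) L)
    ≡⟨ cong ((if e x then countB e L C n else 0) +_) (hockey-stick L-incr e n) ⟩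
  (if e x then countB e L C n else 0) + countB e L C suc n
    ≡⟨ pascal ⟩
  countB e (x ∷ L) C suc n ∎
  where
  open ≡-Reasoning
  above : ℕ → List ℕ → ℕ
  above a = countB (λ y → e y ∧ (a <ᵇ y))

  above-x : above x (x ∷ L) ≡ countB e L
  above-x rewrite <ᵇ-false (<-irrefl (refl {x = x})) | ∧-zeroʳ (e x) =
    countB-congᴬ (All.map (λ {y} x<y → trans (cong (e y ∧_) (<ᵇ-true x<y)) (∧-identityʳ (e y))) x<L)

  above-a : ∀ {a} → x < a → above a (x ∷ L) ≡ above a L
  above-a {a} x<a rewrite <ᵇ-false (<-asym x<a) | ∧-zeroʳ (e x) = refl

  pascal : (if e x then countB e L C n else 0) + countB e L C suc n ≡ countB e (x ∷ L) C suc n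
  pascal with e x
  ... | true  = nCk+nC[k+1]≡[n+1]C[k+1] (countB e L) n
  ... | false = refl

count-increasing : {L : List ℕ} → AllPairs _<_ L → (e : ℕ → Bool) (n : ℕ) →
                   countB (λ w → all e w ∧ allPairsᵇ _<ᵇ_ w) (words n L) ≡ countB e L C n
count-increasing         L-incr e zero    = refl
count-increasing {L} L-incr e (suc n) = begin
  countB (λ w → all e w ∧ allPairsᵇ _<ᵇ_ w) (words (suc n) L)
    ≡⟨ countB-words-suc _<ᵇ_ e n L ⟩
  sum (map (λ a → if e a then countB (λ w → all (λ y → e y ∧ (a <ᵇ y)) w ∧ allPairsᵇ _<ᵇ_ w) (words n L) else 0) L)
    ≡⟨ sum-congᴬ (All.universal (λ a → cong (λ m → if e a then m else 0) (count-increasing L-incr _ n)) L) ⟩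
  sum (map (λ a → if e a then countB (λ y → e y ∧ (a <ᵇ y)) L C n else 0) L)
    ≡⟨ hockey-stick L-incr e n ⟩
  countB e L C suc n ∎
  where open ≡-Reasoning

fallingFactorial : ℕ → ℕ → ℕ
fallingFactorial m zero    = 1
fallingFactorial m (suc n) = m * fallingFactorial (pred m) n

count-injective : {L : List ℕ} → Unique L → (e : ℕ → Bool) (n : ℕ) →
                  countB (λ w → all e w ∧ allPairsᵇ (λ x y → not (x ≡ᵇ y)) w) (words n L) ≡ fallingFactorial (countB e L) n
count-injective         L-uniq e zero    = refl
count-injective {L} L-uniq e (suc n) = begin
  countB (λ w → all e w ∧ allPairsᵇ _≢ᵇ_ w) (words (suc n) L)
    ≡⟨ countB-words-suc _≢ᵇ_ e n L ⟩
  sum (map (λ a → if e a then injective-from a else 0) L)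
    ≡⟨ sum-congᴬ (All.tabulate each) ⟩
  sum (map (λ a → if e a then fallingFactorial (pred (countB e L)) n else 0) L)
    ≡⟨ sum-if e _ L ⟩
  fallingFactorial (countB e L) (suc n) ∎
  where
  open ≡-Reasoning
  _≢ᵇ_ : ℕ → ℕ → Bool
  x ≢ᵇ y = not (x ≡ᵇ y)

  injective-from : ℕ → ℕ
  injective-from a = countB (λ w → all (λ y → e y ∧ (a ≢ᵇ y)) w ∧ allPairsᵇ _≢ᵇ_ w) (words n L)

  each : ∀ {a} → a ∈ L → (if e a then injective-from a else 0) ≡ (if e a then fallingFactorial (pred (countB e L)) n else 0)
  each {a} a∈ with e a in ea
  ... | true  = trans (count-injective L-uniq _ n) (cong (λ m → fallingFactorial m n) (countB-∧≢ᵇ L-uniq e a∈ ea))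
  ... | false = refl

[1+n]*[1+m]C[1+n]≡[1+m]*mCn : ∀ m n → suc n * (suc m C suc n) ≡ suc m * (m C n)
[1+n]*[1+m]C[1+n]≡[1+m]*mCn zero    zero    = refl
[1+n]*[1+m]C[1+n]≡[1+m]*mCn zero    (suc n) = *-zeroʳ (suc (suc n))
[1+n]*[1+m]C[1+n]≡[1+m]*mCn (suc m) zero    = trans (+-identityʳ _) (trans (nC1≡n (suc (suc m))) (sym (*-identityʳ _)))
[1+n]*[1+m]C[1+n]≡[1+m]*mCn (suc m) (suc n) = begin
  suc (suc n) * (suc (suc m) C suc (suc n))
    ≡⟨ cong (suc (suc n) *_) (sym (nCk+nC[k+1]≡[n+1]C[k+1] (suc m) (suc n))) ⟩
  suc (suc n) * (X + suc m C suc (suc n))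
    ≡⟨ *-distribˡ-+ (suc (suc n)) X _ ⟩
  suc (suc n) * X + suc (suc n) * (suc m C suc (suc n))
    ≡⟨ cong₂ _+_ (cong (X +_) ([1+n]*[1+m]C[1+n]≡[1+m]*mCn m n)) ([1+n]*[1+m]C[1+n]≡[1+m]*mCn m (suc n)) ⟩
  (X + suc m * (m C n)) + suc m * (m C suc n)
    ≡⟨ +-assoc X _ _ ⟩
  X + (suc m * (m C n) + suc m * (m C suc n))
    ≡⟨ cong (X +_) (sym (*-distribˡ-+ (suc m) (m C n) _)) ⟩
  X + suc m * (m C n + m C suc n)
    ≡⟨ cong (λ Y → X + suc m * Y) (nCk+nC[k+1]≡[n+1]C[k+1] m n) ⟩
  suc (suc m) * X ∎
  where
  open ≡-Reasoning
  X = suc m C suc n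

fallingFactorial≡C*! : ∀ m n → fallingFactorial m n ≡ (m C n) * n !
fallingFactorial≡C*! m       zero    = sym (*-identityʳ 1)
fallingFactorial≡C*! zero    (suc n) = refl
fallingFactorial≡C*! (suc m) (suc n) = begin
  suc m * fallingFactorial m n         ≡⟨ cong (suc m *_) (fallingFactorial≡C*! m n) ⟩
  suc m * ((m C n) * n !)              ≡⟨ sym (*-assoc (suc m) (m C n) (n !)) ⟩
  suc m * (m C n) * n !                ≡⟨ cong (_* n !) (sym ([1+n]*[1+m]C[1+n]≡[1+m]*mCn m n)) ⟩
  suc n * (suc m C suc n) * n !        ≡⟨ cong (_* n !) (*-comm (suc n) (suc m C suc n)) ⟩
  (suc m C suc n) * suc n * n !        ≡⟨ *-assoc (suc m C suc n) (suc n) (n !) ⟩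
  (suc m C suc n) * (suc n * n !)      ∎
  where open ≡-Reasoning

upTo-increasing : ∀ k → AllPairs _<_ (upTo k)
upTo-increasing k = AllPairs.applyUpTo⁺₁ id k (λ i<j _ → i<j)

upTo-unique : ∀ k → Unique (upTo k)
upTo-unique k = AllPairs.map <⇒≢ (upTo-increasing k)

countB-true-upTo : ∀ k → countB (λ _ → true) (upTo k) ≡ k
countB-true-upTo k = trans (countB-true (upTo k)) (length-upTo k)

countB-allPairsᵇ : (ok : ℕ → ℕ → Bool) (n : ℕ) (L : List ℕ) →
                   countB (allPairsᵇ ok) (words n L) ≡ countB (λ w → all (λ _ → true) w ∧ allPairsᵇ ok w) (words n L)
countB-allPairsᵇ ok n L = countB-cong (λ w → cong (_∧ allPairsᵇ ok w) (sym (all-true w))) (words n L)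

count-constant-upTo : ∀ n k → countB (allPairsᵇ _≡ᵇ_) (words (suc n) (upTo k)) ≡ k
count-constant-upTo n k = trans (countB-allPairsᵇ _≡ᵇ_ (suc n) (upTo k))
  (trans (count-constant (upTo-unique k) (λ _ → true) n) (countB-true-upTo k))

count-increasing-upTo : ∀ n k → countB (allPairsᵇ _<ᵇ_) (words n (upTo k)) ≡ k C n
count-increasing-upTo n k = trans (countB-allPairsᵇ _<ᵇ_ n (upTo k))
  (trans (count-increasing (upTo-increasing k) (λ _ → true) n) (cong (_C n) (countB-true-upTo k)))

count-injective-upTo : ∀ n k → countB (allPairsᵇ (λ x y → not (x ≡ᵇ y))) (words n (upTo k)) ≡ (k C n) * n !
count-injective-upTo n k = trans (countB-allPairsᵇ _ n (upTo k))
  (trans (count-injective (upTo-unique k) (λ _ → true) n)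
         (trans (cong (λ m → fallingFactorial m n) (countB-true-upTo k)) (fallingFactorial≡C*! k n)))

theorem6 : (j : ℕ) → 1 ≤ j → (Υ : List (List ℕ)) → All (_∈ Sym j) Υ →
    (k n : ℕ) → 1 ≤ k → 1 ≤ n →
      (AvC (Γ₁ j Υ) n k ≡ k * AvP Υ n)
      × (AvC (Γ₂ j Υ) n k ≡ (k C n) * AvP Υ n)
      × (AvC (Γ₃ j Υ) n k ≡ (k C n) * (n !) * AvP Υ n)
theorem6 j _ Υ Υ⊆Sym k (suc n) _ _ =
    scale (AvC-Γ₁ j Υ⊆Sym (suc n) k) (count-constant-upTo n k)
  , scale (AvC-Γ₂ j Υ⊆Sym (suc n) k) (count-increasing-upTo (suc n) k)
  , scale (AvC-Γ₃ j Υ⊆Sym (suc n) k) (count-injective-upTo (suc n) k)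
  where
  scale : ∀ {a b c} → a ≡ AvP Υ (suc n) * b → b ≡ c → a ≡ c * AvP Υ (suc n)
  scale a≡ b≡c = trans a≡ (trans (cong (AvP Υ (suc n) *_) b≡c) (*-comm (AvP Υ (suc n)) _))
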